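{- The language $\textsc{Primes} = \{u \in \{0,1\}^* \mid \mathrm{bin}(u) \text{ is prime}\}$ does not have sublogarithmic alternating online state complexity, i.e. there is no function $f:\mathbb{N}\to\mathbb{N}$ with $f = o(\log n)$ such that $\textsc{Primes} \in \mathrm{Alt}(f)$.
   Context: For a word $w = w(0)w(1)\cdots w(n-1)\in\{0,1\}^*$, $\mathrm{bin}(w) = \sum_{i=0}^{n-1} w(i)2^i$ (least significant digit on the left). An alternating machine over a finite alphabet $A$ consists of a (possibly infinite) set of states $Q$, an initial state $q_0\in Q$, a transition function $\delta: Q\times A\to\mathcal{B}^+(Q)$ (positive boolean formulae over $Q$) and a set $F\subseteq Q$ of accepting states. For an input word $w$, the acceptance game $\mathcal{G}_{\mathcal{A},w}$ is played by Prover and Verifier: starting in $q_0$, the letters of $w$ are read from left to right; in state $q$ reading letter $a$, the next state is obtained from the formula $\delta(q,a)$, Prover resolving disjunctions and Verifier resolving conjunctions. Prover wins a play if it ends in a state of $F$. The word $w$ is accepted if Prover has a winning strategy; the language recognised is the set of accepted words. For $f:\mathbb{N}\to\mathbb{N}$, a language $L$ is in $\mathrm{Alt}(f)$ if there are an alternating machine recognising $L$ and a constant $C$ such that for all $n\in\mathbb{N}$, the number of states $q$ for which there exists a word $w$ of length at most $n$ with $q$ appearing in the game $\mathcal{G}_{\mathcal{A},w}$ is at most $C\cdot f(n)$. -}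

module Defs where

open import Data.Nat using (ℕ; zero; suc; _+_; _*_; _≤_)
open import Data.Nat.Primality using (Prime)
open import Data.Nat.Logarithm using (⌊log₂_⌋)
open import Data.Bool using (Bool; true; false)
open import Data.List using (List; []; _∷_; length)
open import Data.List.Membership.Propositional using (_∈_)
open import Data.Product using (Σ; ∃; _×_; _,_)
open import Data.Sum using (_⊎_)
open import Data.Unit using (⊤)
open import Data.Empty using (⊥)

-- Words over {0,1}: false = 0, true = 1.
Word : Set
Word = List Bool

-- bin(w) = Σ w(i) 2^i, least significant digit first.
bin : Word → ℕ
bin []           = 0
bin (false ∷ w) = 2 * bin w
bin (true ∷ w)  = 1 + 2 * bin w

Language : Set₁
Language = Word → Set

PRIMES : Language
PRIMES u = Prime (bin u)

data PBF (Q : Set) : Set where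
  tt  : PBF Q
  ff  : PBF Q
  atom : Q → PBF Q
  _∧ᶠ_ : PBF Q → PBF Q → PBF Q
  _∨ᶠ_ : PBF Q → PBF Q → PBF Q

record AltMachine : Set₁ where
  field
    Q  : Set
    q₀ : Q
    δ  : Q → Bool → PBF Q
    F  : Q → Set

module _ (M : AltMachine) where
  open AltMachine M

  -- Prover has a winning strategy in the acceptance game, starting from
  -- state q with remaining input w (a finite game: Prover resolves ∨,
  -- Verifier resolves ∧, Prover wins iff the final state is in F).
  mutual
    WinsFrom : Q → Word → Set
    WinsFrom q []       = F q
    WinsFrom q (a ∷ w) = WinsFml (δ q a) w

    WinsFml : PBF Q → Word → Set
    WinsFml tt         w = ⊤
    WinsFml ff         w = ⊥
    WinsFml (atom q)   w = WinsFrom q w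
    WinsFml (φ ∧ᶠ ψ)  w = WinsFml φ w × WinsFml ψ w
    WinsFml (φ ∨ᶠ ψ)  w = WinsFml φ w ⊎ WinsFml ψ w

  Accepts : Word → Set
  Accepts w = WinsFrom q₀ w

  data AtomOf (q : Q) : PBF Q → Set where
    here  : AtomOf q (atom q)
    ∧ˡ : ∀ {φ ψ} → AtomOf q φ → AtomOf q (φ ∧ᶠ ψ)
    ∧ʳ : ∀ {φ ψ} → AtomOf q ψ → AtomOf q (φ ∧ᶠ ψ)
    ∨ˡ : ∀ {φ ψ} → AtomOf q φ → AtomOf q (φ ∨ᶠ ψ)
    ∨ʳ : ∀ {φ ψ} → AtomOf q ψ → AtomOf q (φ ∨ᶠ ψ)

  data AppearsFrom : Q → Word → Q → Set where
    start : ∀ {q w} → AppearsFrom q w q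
    step  : ∀ {q a w q' r} → AtomOf q' (δ q a) → AppearsFrom q' w r →
            AppearsFrom q (a ∷ w) r

  Appears : Word → Q → Set
  Appears w r = AppearsFrom q₀ w r

  Recognises : Language → Set
  Recognises L = ∀ w → (Accepts w → L w) × (L w → Accepts w)

  StatesBoundedBy : ℕ → ℕ → Set
  StatesBoundedBy n k =
    Σ (List Q) λ qs → length qs ≤ k ×
      (∀ r → (Σ Word λ w → length w ≤ n × Appears w r) → r ∈ qs)

Alt : (ℕ → ℕ) → Language → Set₁
Alt f L = Σ AltMachine λ M → Recognises M L ×
          Σ ℕ λ C → ∀ n → StatesBoundedBy M n (C * f n)

-- f = o(log n): for every k, eventually k·f(n) ≤ log₂ n
-- (equivalently ≤ ⌊log₂ n⌋, since the left side is an integer).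
LittleOLog : (ℕ → ℕ) → Set
LittleOLog f = ∀ k → Σ ℕ λ N → ∀ n → N ≤ n → k * f n ≤ ⌊log₂ n ⌋

module Submission where

-- If PRIMES ∈ Alt(f) with f = o(log n), then for n = 2 ^ N the games on words of length ≤ n visit fewer than n
-- states. The sets of states appearing within m steps grow with m, so they stop growing at some m < n, and then
-- the games on all words visit only finitely many states q₁ … q_L. Read over these states, the residual formula
-- left after a prefix is a positive formula, whose meaning is fixed by its truth table on subsets of {q₁ … q_L};
-- hence prefixes fall into at most 2 ^ 2 ^ L Myhill–Nerode classes. Pumping a prefix of the binary word of a large
-- prime gives primes A + B·r j with r (j + 1) = c + 2 ^ d · r j. The first of them, q, is odd, so 2 ^ d can be
-- cancelled modulo q, and pigeonholing the r j modulo q yields a later term divisible by q.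

open import Defs
open import Data.Nat
open import Data.Nat.Properties
open import Data.Nat.Divisibility
open import Data.Nat.DivMod using (_mod_; _%_; m≡m%n+[m/n]*n; _/_)
open import Data.Nat.Primality
open import Data.Nat.Primality.Factorisation using (factorise)
open import Data.Nat.ListAction using (product)
open import Data.Nat.Logarithm using (⌊log₂[2^n]⌋≡n)
open import Data.Bool using (Bool; true; false)
open import Data.List using (List; []; _∷_; length; _++_; take; drop)
import Data.List as List
open import Data.List.Membership.Propositional using (_∈_)
open import Data.List.Relation.Unary.Any using (index)
open import Data.List.Relation.Unary.Any.Properties using (lookup-index)
open import Data.List.Properties using (++-assoc; length-++; length-take; length-drop; take++drop≡id; take-[])
open import Data.List.Relation.Unary.All using (_∷_)
open import Data.Fin as Fin using (Fin; toℕ)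
import Data.Fin.Properties as Fin
open import Data.Product using (∃-syntax; _×_; _,_; proj₁; proj₂)
open import Data.Sum using (_⊎_; inj₁; inj₂; [_,_]′)
open import Data.Empty using (⊥; ⊥-elim)
open import Function using (_∘_; id)
open import Data.Fin.Subset using (Subset; ⁅_⁆; _∪_) renaming (⊥ to ∅; _∈_ to _∈ˢ_)
open import Data.Fin.Subset.Properties
  using (∉⊥; x∈⁅x⁆; x∈⁅y⁆⇒x≡y; p⊆p∪q; q⊆p∪q; x∈p∪q⁻) renaming (_∈?_ to _∈ˢ?_)
open import Data.Vec using (tabulate; lookup)
open import Data.Vec.Properties using (tabulate-cong; tabulate∘lookup)
open import Data.Unit using (⊤)
open import Function.Bundles using (Inverse)
open import Relation.Nullary using (¬_; contradiction; Dec; yes; no; does)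
open import Relation.Nullary.Decidable using (_×-dec_; _⊎-dec_)
open import Relation.Binary.PropositionalEquality

-- Number theory

prime∤1 : ∀ {p} → Prime p → ¬ p ∣ 1
prime∤1 p-prime p∣1 = ¬prime[1] (subst Prime (∣1⇒≡1 p∣1) p-prime)

prime-divisor : ∀ n .{{_ : NonZero n}} → n ≢ 1 → ∃[ p ] Prime p × p ∣ n
prime-divisor n n≢1 with factorise n
... | record { factors = [] ; isFactorisation = n≡1 } = contradiction n≡1 n≢1
... | record { factors = p ∷ ps ; isFactorisation = n≡pps ; factorsPrime = p-prime ∷ _ } =
  p , p-prime , subst (p ∣_) (sym n≡pps) (m∣m*n (product ps))

-- Euclid: a prime divisor of 1 + K! exceeds K.
∃-prime> : ∀ K → ∃[ p ] Prime p × K < p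
∃-prime> K with prime-divisor (suc (K !)) (λ eq → <⇒≢ (1≤n! K) (sym (suc-injective eq)))
... | p , p-prime , p∣1+K! = p , p-prime , ≰⇒> p≰K
  where
  p∣p! : ∀ {p} → NonZero p → p ∣ p !
  p∣p! {suc p} _ = m∣m*n (p !)
  p≰K : ¬ p ≤ K
  p≰K p≤K = prime∤1 p-prime (∣m+n∣m⇒∣n (subst (p ∣_) (+-comm 1 (K !)) p∣1+K!)
                                        (∣-trans (p∣p! (prime⇒nonZero p-prime)) (m≤n⇒m!∣n! p≤K)))

prime∤^ : ∀ {p b} → Prime p → ¬ p ∣ b → ∀ d → ¬ p ∣ b ^ d
prime∤^ p-prime p∤b zero    = prime∤1 p-prime
prime∤^ p-prime p∤b (suc d) p∣b*b^d =
  [ p∤b , prime∤^ p-prime p∤b d ]′ (euclidsLemma _ _ p-prime p∣b*b^d)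

odd-prime∤2 : ∀ {h} → Prime (1 + 2 * h) → ¬ (1 + 2 * h) ∣ 2
odd-prime∤2 {h} q-prime q∣2 =
  prime∤1 q-prime (∣m+n∣m⇒∣n (subst (1 + 2 * h ∣_) (+-comm 1 (2 * h)) ∣-refl) (∣-trans q∣2 (m∣m*n h)))

%≡%⇒∣∸ : ∀ a b q .{{_ : NonZero q}} → a % q ≡ b % q → q ∣ a ∸ b
%≡%⇒∣∸ a b q a%q≡b%q = divides (a / q ∸ b / q) (begin
  a ∸ b                                         ≡⟨ cong₂ _∸_ (m≡m%n+[m/n]*n a q) (m≡m%n+[m/n]*n b q) ⟩
  (a % q + (a / q) * q) ∸ (b % q + (b / q) * q) ≡⟨ cong (λ x → _ ∸ (x + (b / q) * q)) a%q≡b%q ⟨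
  (a % q + (a / q) * q) ∸ (a % q + (b / q) * q) ≡⟨ [m+n]∸[m+o]≡n∸o (a % q) _ _ ⟩
  (a / q) * q ∸ (b / q) * q                     ≡⟨ *-distribʳ-∸ q (a / q) (b / q) ⟨
  (a / q ∸ b / q) * q                           ∎)
  where open ≡-Reasoning

residue-collision : ∀ (r : ℕ → ℕ) q .{{_ : NonZero q}} → ∃[ t ] ∃[ k ] q ∣ r (t + suc k) ∸ r t
residue-collision r q with Fin.pigeonhole (n<1+n q) (λ i → r (toℕ i) mod q)
... | i , j , i<j , same-residue =
  toℕ i , toℕ j ∸ suc (toℕ i) ,
  subst (λ s → q ∣ r s ∸ r (toℕ i)) (sym (trans (+-suc (toℕ i) _) (m+[n∸m]≡n i<j)))
        (%≡%⇒∣∸ (r (toℕ j)) (r (toℕ i)) q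
          (trans (sym (Fin.toℕ-fromℕ< _)) (trans (cong toℕ (sym same-residue)) (Fin.toℕ-fromℕ< _))))

module AffineOrbit {c e : ℕ} {r : ℕ → ℕ} (r-suc : ∀ k → r (suc k) ≡ c + e * r k) where

  r[1+a]∸r[1+b] : ∀ a b → r (suc a) ∸ r (suc b) ≡ e * (r a ∸ r b)
  r[1+a]∸r[1+b] a b = begin
    r (suc a) ∸ r (suc b)         ≡⟨ cong₂ _∸_ (r-suc a) (r-suc b) ⟩
    (c + e * r a) ∸ (c + e * r b) ≡⟨ [m+n]∸[m+o]≡n∸o c _ _ ⟩
    e * r a ∸ e * r b             ≡⟨ *-distribˡ-∸ e (r a) (r b) ⟨
    e * (r a ∸ r b)               ∎
    where open ≡-Reasoning

  ∣-shift : ∀ {q} → Prime q → ¬ q ∣ e → ∀ t {k} → q ∣ r (t + k) ∸ r t → q ∣ r k ∸ r 0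
  ∣-shift q-prime q∤e zero        q∣ = q∣
  ∣-shift {q} q-prime q∤e (suc t) {k} q∣ with euclidsLemma e _ q-prime (subst (q ∣_) (r[1+a]∸r[1+b] (t + k) t) q∣)
  ... | inj₁ q∣e = contradiction q∣e q∤e
  ... | inj₂ q∣d = ∣-shift q-prime q∤e t q∣d

  r-increasing : .{{NonZero e}} → ∀ k → r k ≤ r (suc k)
  r-increasing k = begin
    r k         ≤⟨ m≤n*m (r k) e ⟩
    e * r k     ≤⟨ m≤n+m _ c ⟩
    c + e * r k ≡⟨ r-suc k ⟨
    r (suc k)   ∎
    where open ≤-Reasoning

  r0<r[1+k] : .{{NonZero e}} → r 0 < r 1 → ∀ k → r 0 < r (suc k)
  r0<r[1+k] r0<r1 zero    = r0<r1
  r0<r[1+k] r0<r1 (suc k) = <-≤-trans (r0<r[1+k] r0<r1 k) (r-increasing (suc k))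

  -- q = A + B·r 0 divides A + B·r k for the k found by pigeonhole on residues.
  not-all-prime : ∀ {A B} → 0 < B → r 0 < r 1 → ¬ (A + B * r 0) ∣ e → ¬ (∀ k → Prime (A + B * r k))
  not-all-prime {A} {B} B>0 r0<r1 q∤e all-prime = composite⇒¬prime (composite q<N q∣N) (all-prime (suc k))
    where
    q = A + B * r 0
    q-prime = all-prime 0
    instance
      _ = prime⇒nonZero q-prime
      _ = prime⇒nonTrivial q-prime
      _ = ≢-nonZero (λ e≡0 → q∤e (subst (q ∣_) (sym e≡0) (q ∣0)))
    collision = residue-collision r q
    t = proj₁ collision
    k = proj₁ (proj₂ collision)
    r0<rk : r 0 < r (suc k)
    r0<rk = r0<r[1+k] r0<r1 k
    N≡q+ : A + B * r (suc k) ≡ q + B * (r (suc k) ∸ r 0)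
    N≡q+ = begin
      A + B * r (suc k)                       ≡⟨ cong (λ x → A + B * x) (m+[n∸m]≡n (<⇒≤ r0<rk)) ⟨
      A + B * (r 0 + (r (suc k) ∸ r 0))       ≡⟨ cong (A +_) (*-distribˡ-+ B (r 0) _) ⟩
      A + (B * r 0 + B * (r (suc k) ∸ r 0))   ≡⟨ +-assoc A _ _ ⟨
      q + B * (r (suc k) ∸ r 0)               ∎
      where open ≡-Reasoning
    q∣N : q ∣ A + B * r (suc k)
    q∣N = subst (q ∣_) (sym N≡q+)
      (∣m∣n⇒∣m+n ∣-refl (∣-trans (∣-shift q-prime q∤e t (proj₂ (proj₂ collision))) (n∣m*n B)))
    q<N : q < A + B * r (suc k)
    q<N = subst (q <_) (sym N≡q+) (m<m+n q (*-mono-< B>0 (m<n⇒0<n∸m r0<rk)))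

m<n≤m+n*o⇒0<o : ∀ {m n} o → m < n → n ≤ m + n * o → 0 < o
m<n≤m+n*o⇒0<o {m} {n} zero    m<n n≤m+n*0 =
  contradiction (subst (n ≤_) (trans (cong (m +_) (*-zeroʳ n)) (+-identityʳ m)) n≤m+n*0) (<⇒≱ m<n)
m<n≤m+n*o⇒0<o         (suc o) _   _       = z<s

0<n+o*m⇒m<n+o*m : ∀ {n o} m → 1 < o → 0 < n + o * m → m < n + o * m
0<n+o*m⇒m<n+o*m         zero    _   0<n+o*0 = 0<n+o*0
0<n+o*m⇒m<n+o*m {n} {o} (suc m) 1<o _       =
  <-≤-trans (subst (suc m <_) (*-comm (suc m) o) (m<m*n (suc m) o 1<o)) (m≤n+m _ n)

-- Binary words

2*[m+n*o] : ∀ m n o → 2 * (m + n * o) ≡ 2 * m + 2 * n * o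
2*[m+n*o] m n o = trans (*-distribˡ-+ 2 m (n * o)) (cong (2 * m +_) (sym (*-assoc 2 n o)))

bin-++ : ∀ u v → bin (u ++ v) ≡ bin u + 2 ^ length u * bin v
bin-++ []          v = sym (+-identityʳ (bin v))
bin-++ (false ∷ u) v = trans (cong (2 *_) (bin-++ u v)) (2*[m+n*o] (bin u) (2 ^ length u) (bin v))
bin-++ (true ∷ u)  v = cong suc (trans (cong (2 *_) (bin-++ u v)) (2*[m+n*o] (bin u) (2 ^ length u) (bin v)))

bin-< : ∀ u → bin u < 2 ^ length u
bin-< []          = 0<1+n
bin-< (false ∷ u) = *-monoʳ-< 2 (bin-< u)
bin-< (true ∷ u)  = subst (_≤ 2 * 2 ^ length u) (cong suc (+-suc (bin u) (bin u + 0))) (*-monoʳ-≤ 2 (bin-< u))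

increment : Word → Word
increment []          = true ∷ []
increment (false ∷ w) = true ∷ w
increment (true ∷ w)  = false ∷ increment w

bin-increment : ∀ w → bin (increment w) ≡ suc (bin w)
bin-increment []          = refl
bin-increment (false ∷ w) = refl
bin-increment (true ∷ w)  = trans (cong (2 *_) (bin-increment w)) (cong suc (+-suc (bin w) (bin w + 0)))

∃-word : ∀ n → ∃[ w ] bin w ≡ n
∃-word zero    = [] , refl
∃-word (suc n) with ∃-word n
... | w , bin-w≡n = increment w , trans (bin-increment w) (cong suc bin-w≡n)

long-prime-word : ∀ {K} W → Prime (bin W) → 2 ^ suc K < bin W → ∃[ W' ] W ≡ true ∷ W' × K < length W'
long-prime-word []           p-prime ()
long-prime-word {K} (false ∷ W') p-prime big with prime⇒irreducible p-prime (divides (bin W') (*-comm 2 (bin W')))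
... | inj₁ ()
... | inj₂ 2≡p = contradiction 2≡p (<⇒≢ (≤-<-trans (^-monoʳ-≤ 2 {1} {suc K} (s≤s z≤n)) big))
long-prime-word {K} (true ∷ W')  p-prime big = W' , refl , ≰⇒> ¬|W'|≤K
  where
  ¬|W'|≤K : ¬ length W' ≤ K
  ¬|W'|≤K |W'|≤K = <-asym big (<-≤-trans (bin-< (true ∷ W')) (^-monoʳ-≤ 2 (s≤s |W'|≤K)))

-- Pumping

ClassifiesResiduals : Language → ∀ {K} → (Word → Fin K) → Set
ClassifiesResiduals L κ = ∀ u u' v → κ u ≡ κ u' → L (u ++ v) → L (u' ++ v)

pumped : Word → Word → ℕ → Word
pumped z w zero    = w
pumped z w (suc j) = z ++ pumped z w j

pump : ∀ {L K} {κ : Word → Fin K} → ClassifiesResiduals L κ →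
       ∀ {u z} w → κ u ≡ κ (u ++ z) → L (u ++ z ++ w) → ∀ j → L (u ++ pumped z w j)
pump {L} classifies {u} {z} w κu≡κuz L-uzw = L-pumped
  where
  L-pumped : ∀ j → L (u ++ pumped z w j)
  L-pumped zero    = classifies (u ++ z) u w (sym κu≡κuz) (subst L (sym (++-assoc u z w)) L-uzw)
  L-pumped (suc j) = subst L (++-assoc u z _) (classifies u (u ++ z) (pumped z w j) κu≡κuz (L-pumped j))

take-+ : ∀ {A : Set} m n (xs : List A) → take (m + n) xs ≡ take m xs ++ take n (drop m xs)
take-+ zero    n xs       = refl
take-+ (suc m) n []       = sym (take-[] n)
take-+ (suc m) n (x ∷ xs) = cong (x ∷_) (take-+ m n xs)

-- Pigeonhole on the K + 1 prefixes of W of length at most K.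
prefix-collision : ∀ {K} (κ : Word → Fin K) W → K < length W →
  ∃[ u ] ∃[ z ] ∃[ w ] W ≡ u ++ z ++ w × 0 < length z × length (u ++ z) ≤ K × κ u ≡ κ (u ++ z)
prefix-collision {K} κ W K<|W| with Fin.pigeonhole (n<1+n K) (λ i → κ (take (toℕ i) W))
... | i , j , i<j , κ≡ =
  u , z , w , W≡u++z++w , 0<|z| , |u++z|≤K , trans κ≡ (cong κ take-j≡u++z)
  where
  d = toℕ j ∸ toℕ i
  u = take (toℕ i) W
  z = take d (drop (toℕ i) W)
  w = drop d (drop (toℕ i) W)
  W≡u++z++w : W ≡ u ++ z ++ w
  W≡u++z++w = sym (trans (cong (u ++_) (take++drop≡id d (drop (toℕ i) W))) (take++drop≡id (toℕ i) W))
  take-j≡u++z : take (toℕ j) W ≡ u ++ z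
  take-j≡u++z = trans (cong (λ x → take x W) (sym (m+[n∸m]≡n (<⇒≤ i<j)))) (take-+ (toℕ i) d W)
  j≤K : toℕ j ≤ K
  j≤K = Fin.toℕ≤pred[n] j
  |z|≡d : length z ≡ d
  |z|≡d = trans (length-take d (drop (toℕ i) W))
                (m≤n⇒m⊓n≡m (subst (d ≤_) (sym (length-drop (toℕ i) W))
                                        (∸-monoˡ-≤ (toℕ i) (≤-trans j≤K (<⇒≤ K<|W|)))))
  0<|z| : 0 < length z
  0<|z| = subst (0 <_) (sym |z|≡d) (m<n⇒0<n∸m i<j)
  |u++z|≤K : length (u ++ z) ≤ K
  |u++z|≤K = subst (λ x → length x ≤ K) take-j≡u++z
                   (≤-trans (≤-reflexive (length-take (toℕ j) W)) (≤-trans (m⊓n≤m _ _) j≤K))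

-- PRIMES has no finite classifier of residuals

-- bin (true ∷ u ++ pumped z w j) = A + B · r j where r (1 + j) = bin z + 2 ^ |z| · r j, and the j = 0 value is odd.
primes-not-pumpable : ∀ u z w → 0 < length z → 0 < bin (z ++ w) → ¬ (∀ j → PRIMES (true ∷ u ++ pumped z w j))
primes-not-pumpable u z w 0<|z| 0<bin[z++w] pumpable =
  not-all-prime {bin U} {2 ^ length U} (m^n>0 2 (length U)) r0<r1 q∤2^|z| all-prime
  where
  U = true ∷ u
  r : ℕ → ℕ
  r j = bin (pumped z w j)
  open AffineOrbit {bin z} {2 ^ length z} {r} (λ j → bin-++ z (pumped z w j))
  all-prime : ∀ j → Prime (bin U + 2 ^ length U * r j)
  all-prime j = subst Prime (bin-++ U (pumped z w j)) (pumpable j)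
  q∤2^|z| : ¬ (bin U + 2 ^ length U * r 0) ∣ 2 ^ length z
  q∤2^|z| = subst (λ q → ¬ q ∣ 2 ^ length z) (bin-++ U w)
                  (prime∤^ {b = 2} (pumpable 0) (odd-prime∤2 {bin (u ++ w)} (pumpable 0)) (length z))
  r0<r1 : r 0 < r 1
  r0<r1 = subst (r 0 <_) (sym (bin-++ z w))
                (0<n+o*m⇒m<n+o*m {bin z} {2 ^ length z} (bin w) (^-monoʳ-≤ 2 {1} 0<|z|)
                                 (subst (0 <_) (bin-++ z w) 0<bin[z++w]))

PRIMES-has-no-finite-classifier : ∀ {K} (κ : Word → Fin K) → ¬ ClassifiesResiduals PRIMES κ
PRIMES-has-no-finite-classifier {K} κ classifies with ∃-prime> (2 ^ suc K)
... | p , p-prime , p>2^[1+K] with ∃-word p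
... | W , refl with long-prime-word {K} W p-prime p>2^[1+K]
... | W' , refl , K<|W'| with prefix-collision (κ ∘ (true ∷_)) W' K<|W'|
... | u , z , w , refl , 0<|z| , |u++z|≤K , κ≡ =
  primes-not-pumpable u z w 0<|z| 0<bin[z++w] (pump {PRIMES} classifies w κ≡ p-prime)
  where
  U = true ∷ u
  2^|U|≤2^[1+K] : 2 ^ length U ≤ 2 ^ suc K
  2^|U|≤2^[1+K] = ^-monoʳ-≤ 2 (s≤s (≤-trans (m≤m+n (length u) (length z)) (subst (_≤ K) (length-++ u) |u++z|≤K)))
  0<bin[z++w] : 0 < bin (z ++ w)
  0<bin[z++w] = m<n≤m+n*o⇒0<o (bin (z ++ w)) (bin-< U)
    (≤-trans 2^|U|≤2^[1+K] (<⇒≤ (subst (2 ^ suc K <_) (bin-++ U (z ++ w)) p>2^[1+K])))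

-- Positive boolean formulae

⟦_⟧ : ∀ {A : Set} → PBF A → (A → Set) → Set
⟦ tt ⟧     ρ = ⊤
⟦ ff ⟧     ρ = ⊥
⟦ atom a ⟧ ρ = ρ a
⟦ φ ∧ᶠ ψ ⟧ ρ = ⟦ φ ⟧ ρ × ⟦ ψ ⟧ ρ
⟦ φ ∨ᶠ ψ ⟧ ρ = ⟦ φ ⟧ ρ ⊎ ⟦ ψ ⟧ ρ

⟦⟧-mono : ∀ {A} (φ : PBF A) {ρ σ : A → Set} → (∀ {a} → ρ a → σ a) → ⟦ φ ⟧ ρ → ⟦ φ ⟧ σ
⟦⟧-mono tt       ρ⊆σ _          = _
⟦⟧-mono (atom a) ρ⊆σ ρa         = ρ⊆σ ρa
⟦⟧-mono (φ ∧ᶠ ψ) ρ⊆σ (φρ , ψρ)  = ⟦⟧-mono φ ρ⊆σ φρ , ⟦⟧-mono ψ ρ⊆σ ψρ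
⟦⟧-mono (φ ∨ᶠ ψ) ρ⊆σ (inj₁ φρ)  = inj₁ (⟦⟧-mono φ ρ⊆σ φρ)
⟦⟧-mono (φ ∨ᶠ ψ) ρ⊆σ (inj₂ ψρ)  = inj₂ (⟦⟧-mono ψ ρ⊆σ ψρ)

⟦_⟧? : ∀ {A} (φ : PBF A) {ρ : A → Set} → (∀ a → Dec (ρ a)) → Dec (⟦ φ ⟧ ρ)
⟦ tt ⟧?     ρ? = yes _
⟦ ff ⟧?     ρ? = no λ ()
⟦ atom a ⟧? ρ? = ρ? a
⟦ φ ∧ᶠ ψ ⟧? ρ? = ⟦ φ ⟧? ρ? ×-dec ⟦ ψ ⟧? ρ?
⟦ φ ∨ᶠ ψ ⟧? ρ? = ⟦ φ ⟧? ρ? ⊎-dec ⟦ ψ ⟧? ρ?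

does≡⇒ : ∀ {P Q : Set} (P? : Dec P) (Q? : Dec Q) → does P? ≡ does Q? → P → Q
does≡⇒ (yes _) (yes q) _  _ = q
does≡⇒ (no ¬p) _       _  p = contradiction p ¬p
does≡⇒ (yes _) (no _)  () _

module _ {n : ℕ} where

  ⟦⟧-support : ∀ (φ : PBF (Fin n)) {ρ} → ⟦ φ ⟧ ρ → ∃[ S ] ⟦ φ ⟧ (_∈ˢ S) × (∀ {i} → i ∈ˢ S → ρ i)
  ⟦⟧-support tt                _         = ∅ , _ , λ i∈∅ → contradiction i∈∅ ∉⊥
  ⟦⟧-support (atom i)     {ρ}  ρi        =
    ⁅ i ⁆ , x∈⁅x⁆ i , λ j∈⁅i⁆ → subst ρ (sym (x∈⁅y⁆⇒x≡y i j∈⁅i⁆)) ρi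
  ⟦⟧-support (φ ∧ᶠ ψ)          (φρ , ψρ) with ⟦⟧-support φ φρ | ⟦⟧-support ψ ψρ
  ... | S , φS , S⊆ρ | T , ψT , T⊆ρ =
    S ∪ T , (⟦⟧-mono φ (p⊆p∪q T) φS , ⟦⟧-mono ψ (q⊆p∪q S T) ψT) ,
    λ i∈S∪T → [ S⊆ρ , T⊆ρ ]′ (x∈p∪q⁻ S T i∈S∪T)
  ⟦⟧-support (φ ∨ᶠ ψ)          (inj₁ φρ) with ⟦⟧-support φ φρ
  ... | S , φS , S⊆ρ = S , inj₁ φS , S⊆ρ
  ⟦⟧-support (φ ∨ᶠ ψ)          (inj₂ ψρ) with ⟦⟧-support ψ ψρ
  ... | S , ψS , S⊆ρ = S , inj₂ ψS , S⊆ρ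

  entailment-on-subsets : ∀ (φ ψ : PBF (Fin n)) → (∀ S → ⟦ φ ⟧ (_∈ˢ S) → ⟦ ψ ⟧ (_∈ˢ S)) →
                          ∀ {ρ} → ⟦ φ ⟧ ρ → ⟦ ψ ⟧ ρ
  entailment-on-subsets φ ψ φ⊨ψ φρ with ⟦⟧-support φ φρ
  ... | S , φS , S⊆ρ = ⟦⟧-mono ψ S⊆ρ (φ⊨ψ S φS)

  subsetAt : Fin (2 ^ n) → Subset n
  subsetAt j = tabulate (Inverse.to Fin.2↔Bool ∘ Fin.finToFun j)

  subsetAt-surjective : ∀ S → ∃[ j ] subsetAt j ≡ S
  subsetAt-surjective S = Fin.funToFin (from ∘ lookup S) , (begin
    tabulate (to ∘ Fin.finToFun (Fin.funToFin (from ∘ lookup S)))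
      ≡⟨ tabulate-cong (cong to ∘ Fin.finToFun-funToFin (from ∘ lookup S)) ⟩
    tabulate (to ∘ from ∘ lookup S)
      ≡⟨ tabulate-cong (strictlyInverseˡ ∘ lookup S) ⟩
    tabulate (lookup S)
      ≡⟨ tabulate∘lookup S ⟩
    S ∎)
    where
    open Inverse Fin.2↔Bool using (to; from; strictlyInverseˡ)
    open ≡-Reasoning

  -- The truth table of φ on all subsets, encoded as a number.
  profile : PBF (Fin n) → Fin (2 ^ (2 ^ n))
  profile φ = Fin.funToFin (truth-table φ)
    where
    truth-table : PBF (Fin n) → Fin (2 ^ n) → Fin 2
    truth-table φ j = Inverse.from Fin.2↔Bool (does (⟦ φ ⟧? (λ i → i ∈ˢ? subsetAt j)))

  profile-≡⇒ : ∀ {φ ψ : PBF (Fin n)} → profile φ ≡ profile ψ → ∀ {ρ} → ⟦ φ ⟧ ρ → ⟦ ψ ⟧ ρ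
  profile-≡⇒ {φ} {ψ} same = entailment-on-subsets φ ψ φ⊨ψ
    where
    open Inverse Fin.2↔Bool using (to; strictlyInverseˡ)
    truth-value : PBF (Fin n) → Fin (2 ^ n) → Bool
    truth-value χ j = to (Fin.finToFun (profile χ) j)
    truth-value-correct : ∀ χ j → truth-value χ j ≡ does (⟦ χ ⟧? (λ i → i ∈ˢ? subsetAt j))
    truth-value-correct χ j = trans (cong to (Fin.finToFun-funToFin _ j)) (strictlyInverseˡ _)
    φ⊨ψ : ∀ S → ⟦ φ ⟧ (_∈ˢ S) → ⟦ ψ ⟧ (_∈ˢ S)
    φ⊨ψ S with subsetAt-surjective S
    ... | j , refl = does≡⇒ (⟦ φ ⟧? _) (⟦ ψ ⟧? _)
      (trans (sym (truth-value-correct φ j)) (trans (cong (λ c → to (Fin.finToFun c j)) same) (truth-value-correct ψ j)))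

-- Machines whose games visit finitely many states

module _ (M : AltMachine) where
  open AltMachine M

  δᶠ : PBF Q → Bool → PBF Q
  δᶠ tt       a = tt
  δᶠ ff       a = ff
  δᶠ (atom q) a = δ q a
  δᶠ (φ ∧ᶠ ψ) a = δᶠ φ a ∧ᶠ δᶠ ψ a
  δᶠ (φ ∨ᶠ ψ) a = δᶠ φ a ∨ᶠ δᶠ ψ a

  δᶠ* : PBF Q → Word → PBF Q
  δᶠ* φ []      = φ
  δᶠ* φ (a ∷ u) = δᶠ* (δᶠ φ a) u

  WinsFml-∷ : ∀ φ a w → WinsFml M φ (a ∷ w) ≡ WinsFml M (δᶠ φ a) w
  WinsFml-∷ tt       a w = refl
  WinsFml-∷ ff       a w = refl
  WinsFml-∷ (atom q) a w = refl
  WinsFml-∷ (φ ∧ᶠ ψ) a w = cong₂ _×_ (WinsFml-∷ φ a w) (WinsFml-∷ ψ a w)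
  WinsFml-∷ (φ ∨ᶠ ψ) a w = cong₂ _⊎_ (WinsFml-∷ φ a w) (WinsFml-∷ ψ a w)

  WinsFml-++ : ∀ φ u v → WinsFml M φ (u ++ v) ≡ WinsFml M (δᶠ* φ u) v
  WinsFml-++ φ []      v = refl
  WinsFml-++ φ (a ∷ u) v = trans (WinsFml-∷ φ a (u ++ v)) (WinsFml-++ (δᶠ φ a) u v)

  AtomOf-δᶠ : ∀ φ a {r} → AtomOf M r (δᶠ φ a) → ∃[ q ] AtomOf M q φ × AtomOf M r (δ q a)
  AtomOf-δᶠ (atom q) a r∈δqa    = q , here , r∈δqa
  AtomOf-δᶠ (φ ∧ᶠ ψ) a (∧ˡ r∈) with AtomOf-δᶠ φ a r∈
  ... | q , q∈φ , r∈δqa = q , ∧ˡ q∈φ , r∈δqa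
  AtomOf-δᶠ (φ ∧ᶠ ψ) a (∧ʳ r∈) with AtomOf-δᶠ ψ a r∈
  ... | q , q∈ψ , r∈δqa = q , ∧ʳ q∈ψ , r∈δqa
  AtomOf-δᶠ (φ ∨ᶠ ψ) a (∨ˡ r∈) with AtomOf-δᶠ φ a r∈
  ... | q , q∈φ , r∈δqa = q , ∨ˡ q∈φ , r∈δqa
  AtomOf-δᶠ (φ ∨ᶠ ψ) a (∨ʳ r∈) with AtomOf-δᶠ ψ a r∈
  ... | q , q∈ψ , r∈δqa = q , ∨ʳ q∈ψ , r∈δqa

  AtomOf-δᶠ* : ∀ φ u {r} → AtomOf M r (δᶠ* φ u) → ∃[ q ] AtomOf M q φ × AppearsFrom M q u r
  AtomOf-δᶠ* φ []      r∈φ = _ , r∈φ , start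
  AtomOf-δᶠ* φ (a ∷ u) r∈  with AtomOf-δᶠ* (δᶠ φ a) u r∈
  ... | q' , q'∈δᶠφa , q'⇝r with AtomOf-δᶠ φ a q'∈δᶠφa
  ... | q , q∈φ , q'∈δqa = q , q∈φ , step q'∈δqa q'⇝r

  appears-δᶠ* : ∀ u {r} → AtomOf M r (δᶠ* (atom q₀) u) → Appears M u r
  appears-δᶠ* u r∈ with AtomOf-δᶠ* (atom q₀) u r∈
  ... | _ , here , q₀⇝r = q₀⇝r

  module _ (qs : List Q) where

    AtomsAmongQs : PBF Q → Set
    AtomsAmongQs φ = ∀ {r} → AtomOf M r φ → r ∈ qs

    reindex : (φ : PBF Q) → AtomsAmongQs φ → PBF (Fin (length qs))
    reindex tt       _      = tt
    reindex ff       _      = ff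
    reindex (atom q) atoms∈ = atom (index (atoms∈ here))
    reindex (φ ∧ᶠ ψ) atoms∈ = reindex φ (atoms∈ ∘ ∧ˡ) ∧ᶠ reindex ψ (atoms∈ ∘ ∧ʳ)
    reindex (φ ∨ᶠ ψ) atoms∈ = reindex φ (atoms∈ ∘ ∨ˡ) ∨ᶠ reindex ψ (atoms∈ ∘ ∨ʳ)

    WinsFml-reindex : ∀ φ (atoms∈ : AtomsAmongQs φ) w →
                      WinsFml M φ w ≡ ⟦ reindex φ atoms∈ ⟧ (λ i → WinsFrom M (List.lookup qs i) w)
    WinsFml-reindex tt       _      w = refl
    WinsFml-reindex ff       _      w = refl
    WinsFml-reindex (atom q) atoms∈ w = cong (λ r → WinsFrom M r w) (lookup-index (atoms∈ here))
    WinsFml-reindex (φ ∧ᶠ ψ) atoms∈ w =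
      cong₂ _×_ (WinsFml-reindex φ (atoms∈ ∘ ∧ˡ) w) (WinsFml-reindex ψ (atoms∈ ∘ ∧ʳ) w)
    WinsFml-reindex (φ ∨ᶠ ψ) atoms∈ w =
      cong₂ _⊎_ (WinsFml-reindex φ (atoms∈ ∘ ∨ˡ) w) (WinsFml-reindex ψ (atoms∈ ∘ ∨ʳ) w)

    module _ (covers : ∀ {w r} → Appears M w r → r ∈ qs) where

      residual-atoms : ∀ u → AtomsAmongQs (δᶠ* (atom q₀) u)
      residual-atoms u r∈ = covers (appears-δᶠ* u r∈)

      residual : Word → PBF (Fin (length qs))
      residual u = reindex (δᶠ* (atom q₀) u) (residual-atoms u)

      Accepts-++ : ∀ u v → Accepts M (u ++ v) ≡ ⟦ residual u ⟧ (λ i → WinsFrom M (List.lookup qs i) v)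
      Accepts-++ u v = trans (WinsFml-++ (atom q₀) u v) (WinsFml-reindex (δᶠ* (atom q₀) u) (residual-atoms u) v)

      prefixClass : Word → Fin (2 ^ (2 ^ length qs))
      prefixClass u = profile (residual u)

      prefixClass-classifies : ClassifiesResiduals (Accepts M) prefixClass
      prefixClass-classifies u u' v same accepts =
        subst id (sym (Accepts-++ u' v))
          (profile-≡⇒ {φ = residual u} {residual u'} same (subst id (Accepts-++ u v) accepts))

-- From short words to all words

¬¬-∀ : ∀ {n} {P : Fin n → Set} → (∀ i → ¬ ¬ P i) → ¬ ¬ (∀ i → P i)
¬¬-∀ {zero}  _   ¬∀P = ¬∀P λ ()
¬¬-∀ {suc n} ¬¬P ¬∀P =
  ¬¬P Fin.zero λ P₀ → ¬¬-∀ (¬¬P ∘ Fin.suc) λ P₊ → ¬∀P λ { Fin.zero → P₀ ; (Fin.suc i) → P₊ i }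

-- Intuitionistic form of: an increasing chain of subsets of Fin L is stationary at one of its first L + 1 steps.
-- If no step were stationary, each step m would (doubly negated) add a new element, and two steps would add the same one.
chain-stabilises : ∀ {L n} {P : ℕ → Fin L → Set} → (∀ {m m' i} → m ≤ m' → P m i → P m' i) → L < n →
                   ¬ (∀ (m : Fin n) → ¬ (∀ i → P (suc (toℕ m)) i → P (toℕ m) i))
chain-stabilises {L} {n} {P} P-mono L<n never-stationary = ¬¬-∀ grows pigeon
  where
  Grows : Fin n → Set
  Grows m = ∃[ i ] ¬ ¬ P (suc (toℕ m)) i × ¬ P (toℕ m) i
  grows : ∀ m → ¬ ¬ Grows m
  grows m no-growth = ¬¬-∀ stationary-at (never-stationary m)
    where
    stationary-at : ∀ i → ¬ ¬ (P (suc (toℕ m)) i → P (toℕ m) i)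
    stationary-at i ¬stationary = ¬stationary λ P[1+m] →
      ⊥-elim (no-growth (i , (λ ¬P[1+m] → ¬P[1+m] P[1+m]) , λ P[m] → ¬stationary λ _ → P[m]))
  pigeon : ¬ (∀ m → Grows m)
  pigeon grow with Fin.pigeonhole L<n (proj₁ ∘ grow)
  ... | a , b , a<b , same =
    proj₁ (proj₂ (grow a)) λ P[1+a] → proj₂ (proj₂ (grow b)) (subst (P (toℕ b)) same (P-mono a<b P[1+a]))

module _ (M : AltMachine) where
  open AltMachine M

  AppearsWithin : ℕ → Q → Set
  AppearsWithin m r = ∃[ w ] length w ≤ m × Appears M w r

  AppearsWithin-mono : ∀ {m m' r} → m ≤ m' → AppearsWithin m r → AppearsWithin m' r
  AppearsWithin-mono m≤m' (w , |w|≤m , q₀⇝r) = w , ≤-trans |w|≤m m≤m' , q₀⇝r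

  -- The start rule lets a state appear before the rest of the word is read, so w itself need not extend.
  appears-extend : ∀ {q w r' a r} → AppearsFrom M q w r' → AtomOf M r (δ r' a) →
                   ∃[ w' ] length w' ≤ suc (length w) × AppearsFrom M q w' r
  appears-extend {a = a} start r∈ = a ∷ [] , s≤s z≤n , step r∈ start
  appears-extend (step {a = b} r∈' q⇝r') r∈ with appears-extend q⇝r' r∈
  ... | w' , |w'|≤ , q'⇝r = b ∷ w' , s≤s |w'|≤ , step r∈' q'⇝r

  AppearsWithin-suc : ∀ {m r' a r} → AppearsWithin m r' → AtomOf M r (δ r' a) → AppearsWithin (suc m) r
  AppearsWithin-suc (w , |w|≤m , q₀⇝r') r∈ with appears-extend q₀⇝r' r∈
  ... | w' , |w'|≤ , q₀⇝r = w' , ≤-trans |w'|≤ (s≤s |w|≤m) , q₀⇝r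

  appears-invariant : ∀ {S : Q → Set} → (∀ {q a r} → S q → AtomOf M r (δ q a) → S r) →
                      ∀ {q w r} → S q → AppearsFrom M q w r → S r
  appears-invariant closed Sq start         = Sq
  appears-invariant closed Sq (step r∈ q⇝) = appears-invariant closed (closed Sq r∈) q⇝

  stationary⇒AppearsWithin : ∀ {m} → (∀ {r} → AppearsWithin (suc m) r → AppearsWithin m r) →
                             ∀ {w r} → Appears M w r → AppearsWithin m r
  stationary⇒AppearsWithin stationary =
    appears-invariant (λ within r∈ → stationary (AppearsWithin-suc within r∈)) ([] , z≤n , start)

  finitely-many-states : ∀ {n} (qs : List Q) → length qs < n → (∀ {r} → AppearsWithin n r → r ∈ qs) →
                         ¬ ¬ (∀ {w r} → Appears M w r → r ∈ qs)
  finitely-many-states {n} qs |qs|<n covers-short ¬covers =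
    chain-stabilises (λ m≤m' → AppearsWithin-mono m≤m') |qs|<n never-stationary
    where
    never-stationary : ∀ (m : Fin n) →
      ¬ (∀ i → AppearsWithin (suc (toℕ m)) (List.lookup qs i) → AppearsWithin (toℕ m) (List.lookup qs i))
    never-stationary m stationary-on-qs = ¬covers λ q₀⇝r →
      covers-short (AppearsWithin-mono (<⇒≤ (Fin.toℕ<n m)) (stationary⇒AppearsWithin stationary q₀⇝r))
      where
      stationary : ∀ {r} → AppearsWithin (suc (toℕ m)) r → AppearsWithin (toℕ m) r
      stationary within with covers-short (AppearsWithin-mono (Fin.toℕ<n m) within)
      ... | r∈qs = subst (AppearsWithin (toℕ m)) (sym (lookup-index r∈qs))
                     (stationary-on-qs (index r∈qs) (subst (AppearsWithin (suc (toℕ m))) (lookup-index r∈qs) within))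

PRIMES-needs-infinitely-many-states : ∀ M → Recognises M PRIMES → (qs : List (AltMachine.Q M)) →
                                      ¬ (∀ {w r} → Appears M w r → r ∈ qs)
PRIMES-needs-infinitely-many-states M recognises qs covers =
  PRIMES-has-no-finite-classifier (prefixClass M qs covers) λ u u' v same prime-uv →
    proj₁ (recognises (u' ++ v)) (prefixClass-classifies M qs covers u u' v same (proj₂ (recognises (u ++ v)) prime-uv))

n<2^n : ∀ n → n < 2 ^ n
n<2^n zero    = z<s
n<2^n (suc n) = begin-strict
  suc n         <⟨ s<s (n<2^n n) ⟩
  suc (2 ^ n)   ≤⟨ +-monoˡ-≤ (2 ^ n) (m^n>0 2 n) ⟩
  2 ^ n + 2 ^ n ≡⟨ cong (2 ^ n +_) (+-identityʳ (2 ^ n)) ⟨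
  2 ^ suc n     ∎
  where open ≤-Reasoning

corollary1 : (f : ℕ → ℕ) → LittleOLog f → ¬ Alt f PRIMES
corollary1 f f=o[log] (M , recognises , C , bounded) =
  finitely-many-states M qs |qs|<n (λ {r} → covers r) (PRIMES-needs-infinitely-many-states M recognises qs)
  where
  N = proj₁ (f=o[log] C)
  n = 2 ^ N
  Cf[n]≤N : C * f n ≤ N
  Cf[n]≤N = subst (C * f n ≤_) (⌊log₂[2^n]⌋≡n N) (proj₂ (f=o[log] C) n (<⇒≤ (n<2^n N)))
  qs = proj₁ (bounded n)
  |qs|<n : length qs < n
  |qs|<n = ≤-<-trans (proj₁ (proj₂ (bounded n))) (≤-<-trans Cf[n]≤N (n<2^n N))
  covers = proj₂ (proj₂ (bounded n))
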